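{- Consider $n$ nodes placed at the integer points of a segment of the real line, and choose an integer $b > 1$. With $\ell = (b-1)\lceil \log_b n\rceil$, let each node link to the nodes at distances $1x, 2x, 3x, \ldots, (b-1)x$ from it, for each $x \in \{b^0, b^1, \ldots, b^{\lceil \log_b n\rceil - 1}\}$ (whenever such nodes exist). Messages are routed greedily, each node forwarding the message to its neighbor closest to the target. Then the delivery time is $T(n) = O(\log_b n)$.
   Context: The delivery time is the number of hops taken to route a message from a source to a target node. -}

module Defs where

open import Data.Nat using (ℕ; zero; suc; _+_; _*_; _∸_; _^_; _≤_; _<_; _≤ᵇ_; ∣_-_∣)
open import Data.Bool using (if_then_else_)
open import Data.Fin using (Fin; toℕ)
open import Data.Product using (Σ; _×_; ∃; ∃-syntax)
open import Relation.Binary.PropositionalEquality using (_≡_)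
open import Relation.Nullary using (¬_)

-- ⌈log_b n⌉ = the least m with n ≤ b ^ m (searching m = 0,1,…,n;
-- for b ≥ 2 we have n ≤ b ^ n, so the search is exhaustive).
clogGo : ℕ → ℕ → ℕ → ℕ → ℕ
clogGo b n zero    m = m
clogGo b n (suc f) m = if n ≤ᵇ b ^ m then m else clogGo b n f (suc m)

⌈log[_]_⌉ : ℕ → ℕ → ℕ
⌈log[ b ] n ⌉ = clogGo b n n 0

dist : {n : ℕ} → Fin n → Fin n → ℕ
dist u v = ∣ toℕ u - toℕ v ∣

Link : (n b : ℕ) → Fin n → Fin n → Set
Link n b u v = ∃[ k ] ∃[ i ] (1 ≤ k × k ≤ b ∸ 1 × i < ⌈log[ b ] n ⌉ × dist u v ≡ k * b ^ i)

GreedyNext : (n b : ℕ) → Fin n → Fin n → Fin n → Set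
GreedyNext n b t u v =
  ¬ (u ≡ t) × Link n b u v × ((w : Fin n) → Link n b u w → dist v t ≤ dist w t)

-- A greedy routing walk of k hops starting at u towards target t
-- (a prefix of the routing process, under some tie-breaking).
data GreedyWalk (n b : ℕ) (t : Fin n) : ℕ → Fin n → Set where
  stop : ∀ {u} → GreedyWalk n b t 0 u
  hop  : ∀ {k u v} → GreedyNext n b t u v → GreedyWalk n b t k v → GreedyWalk n b t (suc k) u

data Delivers (n b : ℕ) (t : Fin n) : ℕ → Fin n → Set where
  arrived : Delivers n b t 0 t
  hop     : ∀ {k u v} → GreedyNext n b t u v → Delivers n b t k v → Delivers n b t (suc k) u

{-# OPTIONS --safe #-}
-- Write d for the distance to the target and L = ⌈log_b n⌉, so d < n ≤ b ^ L.
-- If 0 < d < b ^ (j + 1) with j < L, the node has a link of length q · b ^ j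
-- towards the target, q = ⌊d / b ^ j⌋ being the leading base-b digit of d
-- (or a link of length 1 if that digit is 0), and following it leaves a
-- distance below b ^ j. The greedy neighbour is at least as close, so every hop
-- removes a base-b digit: at most L hops, and the walk always exists because
-- a closest neighbour does.
module Submission where

open import Defs
open import Data.Nat using (ℕ; zero; suc; _+_; _*_; _∸_; _^_; _⊔_; _≤_; _<_; _≤ᵇ_; ∣_-_∣; z≤n; s≤s; z<s; _≤?_; _<?_; _≟_; NonZero; >-nonZero; anyUpTo?)
open import Data.Nat.Properties
open import Data.Nat.DivMod using (_/_; m%n<n; m%n≡m∸m/n*n; m/n*n≤m; m≥n⇒m/n>0; m<n*o⇒m/o<n)
open import Data.Fin using (Fin; toℕ; fromℕ<)
import Data.Fin.Properties as Fin
open import Data.List using (allFin; filter)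
open import Data.List.Extrema ≤-totalOrder using (argmin; argmin-all; f[argmin]≤f[xs])
open import Data.List.Relation.Unary.All using (lookup)
open import Data.List.Relation.Unary.All.Properties using (all-filter)
open import Data.List.Membership.Propositional.Properties using (∈-filter⁺; ∈-allFin)
open import Data.Bool using (true; false; T)
open import Data.Unit using (tt)
open import Data.Product using (_×_; _,_; ∃; ∃-syntax)
open import Data.Sum using (inj₁; inj₂)
open import Function using (_∘_)
open import Relation.Unary using (Pred; Decidable)
open import Relation.Nullary using (yes; no; contradiction)
open import Relation.Nullary.Decidable using (map′; _×-dec_)
open import Relation.Binary.PropositionalEquality using (_≡_; _≢_; refl; sym; trans; cong; subst; module ≡-Reasoning)

∣m-n∣-between-≤ : ∀ {x y} a → x ≤ y → a ≤ ∣ x - y ∣ →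
  x + a ≤ y × ∣ x + a - y ∣ ≡ ∣ x - y ∣ ∸ a
∣m-n∣-between-≤ {x} {y} a x≤y a≤d = x+a≤y , (begin
  ∣ x + a - y ∣  ≡⟨ m≤n⇒∣m-n∣≡n∸m x+a≤y ⟩
  y ∸ (x + a)    ≡⟨ ∸-+-assoc y x a ⟨
  y ∸ x ∸ a      ≡⟨ cong (_∸ a) (m≤n⇒∣m-n∣≡n∸m x≤y) ⟨
  ∣ x - y ∣ ∸ a  ∎)
  where
  open ≡-Reasoning
  x+a≤y : x + a ≤ y
  x+a≤y = subst (x + a ≤_) (m+[n∸m]≡n x≤y)
                (+-monoʳ-≤ x (subst (a ≤_) (m≤n⇒∣m-n∣≡n∸m x≤y) a≤d))

∣m-n∣-between : ∀ x y a → a ≤ ∣ x - y ∣ →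
  ∃[ z ] (z ≤ x ⊔ y × ∣ x - z ∣ ≡ a × ∣ z - y ∣ ≡ ∣ x - y ∣ ∸ a)
∣m-n∣-between x y a a≤d with ≤-total x y
... | inj₁ x≤y =
  let z≤y , e = ∣m-n∣-between-≤ a x≤y a≤d in
  x + a , m≤n⇒m≤o⊔n x z≤y , ∣m-m+n∣≡n x a , e
-- For y ≤ x, walk from y towards x by the complementary amount.
... | inj₂ y≤x =
  let c = ∣ x - y ∣ ∸ a
      d≡ = ∣-∣-comm y x
      z≤x , e = ∣m-n∣-between-≤ c y≤x (subst (c ≤_) (sym d≡) (m∸n≤m ∣ x - y ∣ a))
  in y + c , m≤n⇒m≤n⊔o y z≤x
     , trans (∣-∣-comm x (y + c)) (trans e (trans (cong (_∸ c) d≡) (m∸[m∸n]≡n a≤d)))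
     , trans (∣-∣-comm (y + c) y) (∣m-m+n∣≡n y c)

toℕ⊔toℕ<n : ∀ {n} (u v : Fin n) → toℕ u ⊔ toℕ v < n
toℕ⊔toℕ<n u v = ⊔-lub (Fin.toℕ<n u) (Fin.toℕ<n v)

dist<n : ∀ {n} (u v : Fin n) → dist u v < n
dist<n u v = ≤-<-trans (∣m-n∣≤m⊔n (toℕ u) (toℕ v)) (toℕ⊔toℕ<n u v)

dist≡0⇒≡ : ∀ {n} {u v : Fin n} → dist u v ≡ 0 → u ≡ v
dist≡0⇒≡ = Fin.toℕ-injective ∘ ∣m-n∣≡0⇒m≡n

step-towards : ∀ {n} (u t : Fin n) a → a ≤ dist u t →
  ∃[ w ] (dist u w ≡ a × dist w t ≡ dist u t ∸ a)
step-towards u t a a≤d =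
  let z , z≤ , e₁ , e₂ = ∣m-n∣-between (toℕ u) (toℕ t) a a≤d
      z<n = ≤-<-trans z≤ (toℕ⊔toℕ<n u t)
      toℕw≡z = Fin.toℕ-fromℕ< z<n
  in fromℕ< z<n , trans (cong (λ x → ∣ toℕ u - x ∣) toℕw≡z) e₁
                , trans (cong (λ x → ∣ x - toℕ t ∣) toℕw≡z) e₂

minimiser : ∀ {n p} {P : Pred (Fin n) p} → Decidable P → (f : Fin n → ℕ) →
  ∃ P → ∃[ v ] (P v × (∀ w → P w → f v ≤ f w))
minimiser {n} P? f (w , Pw) =
  argmin f w xs , argmin-all f Pw (all-filter P? (allFin n)) ,
  λ w′ Pw′ → lookup (f[argmin]≤f[xs] w xs) (∈-filter⁺ P? (∈-allFin w′) Pw′)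
  where xs = filter P? (allFin n)

link? : ∀ n b (u : Fin n) → Decidable (Link n b u)
link? n b u v = map′
  (λ (k , _ , i , _ , p) → k , i , p)
  (λ (k , i , p@(_ , k≤ , i<L , _)) → k , s≤s k≤ , i , i<L , p)
  (anyUpTo? (λ k → anyUpTo? (λ i →
      1 ≤? k ×-dec k ≤? b ∸ 1 ×-dec i <? ⌈log[ b ] n ⌉ ×-dec dist u v ≟ k * b ^ i)
    ⌈log[ b ] n ⌉) (suc (b ∸ 1)))

greedyNext-exists : ∀ {n b} {t u : Fin n} → u ≢ t → ∃ (Link n b u) → ∃ (GreedyNext n b t u)
greedyNext-exists {n} {b} {t} {u} u≢t neighbour =
  let v , u~v , closest = minimiser (link? n b u) (λ v → dist v t) neighbour
  in v , u≢t , u~v , closest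

clogGo-spec : ∀ b n f m → n ≤ b ^ (m + f) → n ≤ b ^ clogGo b n f m
clogGo-spec b n zero    m n≤ = subst (λ e → n ≤ b ^ e) (+-identityʳ m) n≤
clogGo-spec b n (suc f) m n≤ with n ≤ᵇ b ^ m in eq
... | true  = ≤ᵇ⇒≤ n (b ^ m) (subst T (sym eq) tt)
... | false = clogGo-spec b n f (suc m) (subst (λ e → n ≤ b ^ e) (+-suc m f) n≤)

module _ {b : ℕ} (1<b : 1 < b) where

  private instance
    b≢0 : NonZero b
    b≢0 = >-nonZero (<-trans z<s 1<b)

  n<b^n : ∀ n → n < b ^ n
  n<b^n zero    = z<s
  n<b^n (suc n) = ≤-<-trans (n<b^n n) (^-monoʳ-< b 1<b (n<1+n n))

  ≤b^⌈log⌉ : ∀ n → n ≤ b ^ ⌈log[ b ] n ⌉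
  ≤b^⌈log⌉ n = clogGo-spec b n n 0 (<⇒≤ (n<b^n n))

  leading-digit-hop : ∀ j {d} → 0 < d → d < b ^ suc j →
    ∃[ k ] ∃[ i ] (1 ≤ k × k ≤ b ∸ 1 × i ≤ j × k * b ^ i ≤ d × d ∸ k * b ^ i < b ^ j)
  leading-digit-hop j {d} 0<d d<b^1+j with d <? b ^ j
  ... | yes d<b^j = 1 , 0 , ≤-refl {1} , ∸-monoˡ-≤ 1 1<b , z≤n , 0<d , ≤-<-trans (m∸n≤m d 1) d<b^j
  ... | no d≮b^j  = d / b ^ j , j , m≥n⇒m/n>0 (≮⇒≥ d≮b^j) , <⇒≤pred (m<n*o⇒m/o<n {n = b} d<b^1+j) ,
                    ≤-refl , m/n*n≤m d (b ^ j) , subst (_< b ^ j) (m%n≡m∸m/n*n d (b ^ j)) (m%n<n d (b ^ j))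
    where instance
      b^j≢0 : NonZero (b ^ j)
      b^j≢0 = m^n≢0 b j

  module _ {n : ℕ} (t : Fin n) where

    L : ℕ
    L = ⌈log[ b ] n ⌉

    link-closer : ∀ {j u} → j < L → u ≢ t → dist u t < b ^ suc j →
      ∃[ w ] (Link n b u w × dist w t < b ^ j)
    link-closer {j} {u} j<L u≢t d< =
      let k , i , 1≤k , k≤ , i≤j , hop≤d , rest< = leading-digit-hop j 0<d d<
          w , u-w , w-t = step-towards u t (k * b ^ i) hop≤d
      in w , (k , i , 1≤k , k≤ , ≤-<-trans i≤j j<L , u-w) , subst (_< b ^ j) (sym w-t) rest<
      where 0<d = n≢0⇒n>0 (u≢t ∘ dist≡0⇒≡)

    greedy-descent : ∀ {j u v} → GreedyNext n b t u v → j < L → dist u t < b ^ suc j → dist v t < b ^ j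
    greedy-descent (u≢t , _ , closest) j<L d< =
      let w , u~w , w< = link-closer j<L u≢t d<
      in ≤-<-trans (closest w u~w) w<

    walk-length≤ : ∀ {j k s} → j ≤ L → dist s t < b ^ j → GreedyWalk n b t k s → k ≤ j
    walk-length≤ _ _ stop = z≤n
    walk-length≤ {zero} _ d<1 (hop (s≢t , _) _) = contradiction (dist≡0⇒≡ (n<1⇒n≡0 d<1)) s≢t
    walk-length≤ {suc j} j<L d< (hop g walk) = s≤s (walk-length≤ (<⇒≤ j<L) (greedy-descent g j<L d<) walk)

    delivers-within : ∀ {j} s → j ≤ L → dist s t < b ^ j → ∃[ k ] (Delivers n b t k s × k ≤ j)
    delivers-within {zero} s _ d<1 = 0 , subst (Delivers n b t 0) (sym (dist≡0⇒≡ (n<1⇒n≡0 d<1))) arrived , z≤n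
    delivers-within {suc j} s j<L d< with s Fin.≟ t
    ... | yes refl = 0 , arrived , z≤n
    ... | no s≢t =
      let v , g = greedyNext-exists s≢t (let w , s~w , _ = link-closer j<L s≢t d< in w , s~w)
          k , D , k≤j = delivers-within v (<⇒≤ j<L) (greedy-descent g j<L d<)
      in suc k , hop g D , s≤s k≤j

    dist<b^L : ∀ s → dist s t < b ^ L
    dist<b^L s = <-≤-trans (dist<n s t) (≤b^⌈log⌉ n)

theorem6 : (b : ℕ) → 1 < b →
    ∃[ c ] ((n : ℕ) (s t : Fin n) →
      (∃[ k ] (Delivers n b t k s × k ≤ c * ⌈log[ b ] n ⌉ + c))
      × ((k : ℕ) → GreedyWalk n b t k s → k ≤ c * ⌈log[ b ] n ⌉ + c))
theorem6 b 1<b = 1 , λ n s t →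
  let L = ⌈log[ b ] n ⌉
      within : ∀ {k} → k ≤ L → k ≤ 1 * L + 1
      within k≤L = ≤-trans k≤L (≤-trans (m≤n*m L 1) (m≤m+n (1 * L) 1))
      k , D , k≤L = delivers-within 1<b t s ≤-refl (dist<b^L 1<b t s)
  in (k , D , within k≤L) ,
     λ k walk → within (walk-length≤ 1<b t ≤-refl (dist<b^L 1<b t s) walk)
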